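{- Let $A$ and $S$ be subsets of a finite abelian group $Q$ with $|A|=3$, and assume that $S+A=S+(A\setminus\{a\})$ for each $a\in A$. Then $3|S|\ge 2|S+A|$. -}

module Defs where

open import Data.Nat using (ℕ)
open import Data.Fin using (Fin; _≟_)
open import Data.Fin.Properties using (any?)
open import Data.Fin.Subset using (Subset; _∈_)
open import Data.Fin.Subset.Properties using (_∈?_)
open import Data.Vec using (tabulate)
open import Data.Product using (_×_; ∃; _,_)
open import Relation.Nullary using (Dec; does)
open import Relation.Nullary.Decidable using (_×-dec_)
open import Relation.Binary.PropositionalEquality using (_≡_)

-- A finite abelian group Q is modelled (up to isomorphism) as an abelian
-- group structure (with propositional equality) on Fin n; every finite
-- abelian group is isomorphic to one of these via any enumeration.

sumset : {n : ℕ} → (Fin n → Fin n → Fin n) → Subset n → Subset n → Subset n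
sumset {n} _·_ S A = tabulate λ x → does (dec x)
  where
  dec : (x : Fin n) → Dec (∃ λ s → ∃ λ a → (s ∈ S × a ∈ A) × (s · a) ≡ x)
  dec x = any? λ s → any? λ a → ((s ∈? S) ×-dec (a ∈? A)) ×-dec ((s · a) ≟ x)

{-# OPTIONS --safe #-}
module Submission where

-- Count, for every x, its representations x = s + a with s ∈ S and a ∈ A.
-- Summed over x these number |A| |S|, since each a ∈ A contributes the
-- translate S + a.  If x = s + a, then x ∈ S + (A ∖ {a}) provides a second
-- representation with a different summand from A, so every element of S + A
-- has at least two representations and 2 |S + A| ≤ |A| |S|.  The argument
-- works in any finite group and for any A.

open import Defs
open import Level using (0ℓ)
open import Algebra.Bundles using (Group)
open import Algebra.Core using (Op₁; Op₂)
open import Algebra.Structures using (IsGroup; IsAbelianGroup)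
import Algebra.Properties.Group as GroupProperties
open import Data.Bool using (if_then_else_)
open import Data.Nat using (ℕ; suc; _+_; _*_; _≤_)
open import Data.Nat.Properties
  using (+-*-semiring; +-mono-≤; +-monoʳ-≤; +-comm; *-suc; *-zeroʳ; m≤m+n; m≤n+m; ≤-reflexive; ≤-trans; module ≤-Reasoning)
open import Data.Fin using (Fin; _≟_) renaming (zero to fzero; suc to fsuc)
open import Data.Fin.Properties using (any?)
open import Data.Fin.Permutation using (permutation)
open import Data.Fin.Subset using (Subset; _∈_; _∉_; _─_; _-_; ⁅_⁆; ∣_∣; inside; outside)
open import Data.Fin.Subset.Properties using (_∈?_; p─q⊆p; x∉⁅y⁆⇒x≢y)
open import Data.Product using (_×_; ∃; _,_)
open import Data.Vec using (_∷_; []; here; there; lookup; tabulate)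
open import Data.Vec.Properties using (lookup∘tabulate; []=⇒lookup)
open import Function using (_∘_)
open import Relation.Nullary using (Dec; does; yes; contradiction)
open import Relation.Nullary.Decidable using (_×-dec_)
open import Relation.Unary using (Pred; Decidable)
open import Relation.Binary.PropositionalEquality
  using (_≡_; _≢_; refl; sym; trans; cong; cong₂; subst; module ≡-Reasoning)

open import Algebra.Properties.Semiring.Sum +-*-semiring
  using (sum; sum-cong-≗; sum-permute; ∑-comm; *-distribˡ-sum; *-distribʳ-sum)

f[i]≤sum : ∀ {n} (f : Fin n → ℕ) i → f i ≤ sum f
f[i]≤sum f fzero    = m≤m+n _ _
f[i]≤sum f (fsuc i) = ≤-trans (f[i]≤sum (f ∘ fsuc) i) (m≤n+m _ _)

f[i]+f[j]≤sum : ∀ {n} (f : Fin n → ℕ) {i j} → i ≢ j → f i + f j ≤ sum f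
f[i]+f[j]≤sum f {fzero}  {fzero}  i≢j = contradiction refl i≢j
f[i]+f[j]≤sum f {fzero}  {fsuc j} _   = +-monoʳ-≤ (f fzero) (f[i]≤sum (f ∘ fsuc) j)
f[i]+f[j]≤sum f {fsuc i} {fzero}  _   =
  ≤-trans (≤-reflexive (+-comm (f (fsuc i)) (f fzero))) (+-monoʳ-≤ (f fzero) (f[i]≤sum (f ∘ fsuc) i))
f[i]+f[j]≤sum f {fsuc i} {fsuc j} i≢j =
  ≤-trans (f[i]+f[j]≤sum (f ∘ fsuc) (i≢j ∘ cong fsuc)) (m≤n+m _ _)

k*∣p∣≤sum : ∀ {n} k (p : Subset n) (f : Fin n → ℕ) → (∀ x → x ∈ p → k ≤ f x) → k * ∣ p ∣ ≤ sum f
k*∣p∣≤sum k []            f _ = ≤-reflexive (*-zeroʳ k)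
k*∣p∣≤sum k (inside ∷ p)  f k≤f = begin
  k * suc ∣ p ∣        ≡⟨ *-suc k ∣ p ∣ ⟩
  k + k * ∣ p ∣        ≤⟨ +-mono-≤ (k≤f fzero here) (k*∣p∣≤sum k p (f ∘ fsuc) (λ x → k≤f (fsuc x) ∘ there)) ⟩
  f fzero + sum (f ∘ fsuc) ∎
  where open ≤-Reasoning
k*∣p∣≤sum k (outside ∷ p) f k≤f =
  ≤-trans (k*∣p∣≤sum k p (f ∘ fsuc) (λ x → k≤f (fsuc x) ∘ there)) (m≤n+m _ _)

𝟙 : ∀ {n} → Subset n → Fin n → ℕ
𝟙 p x = if lookup p x then 1 else 0

∣p∣≡sum𝟙 : ∀ {n} (p : Subset n) → ∣ p ∣ ≡ sum (𝟙 p)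
∣p∣≡sum𝟙 []            = refl
∣p∣≡sum𝟙 (inside ∷ p)  = cong suc (∣p∣≡sum𝟙 p)
∣p∣≡sum𝟙 (outside ∷ p) = ∣p∣≡sum𝟙 p

x∈p⇒𝟙≡1 : ∀ {n} {p : Subset n} {x} → x ∈ p → 𝟙 p x ≡ 1
x∈p⇒𝟙≡1 x∈p rewrite []=⇒lookup x∈p = refl

x∈p─q⇒x∉q : ∀ {n} {p q : Subset n} {x} → x ∈ p ─ q → x ∉ q
x∈p─q⇒x∉q {p = _ ∷ _} {_ ∷ _} (there x∈) (there x∈q) = x∈p─q⇒x∉q x∈ x∈q

∈-tabulate⁻ : ∀ {n p} {P : Pred (Fin n) p} (P? : Decidable P) {x} → x ∈ tabulate (does ∘ P?) → P x
∈-tabulate⁻ P? {x} x∈ with P? x | trans (sym (lookup∘tabulate (does ∘ P?) x)) ([]=⇒lookup x∈)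
... | yes Px | _ = Px

module _ {n : ℕ} (_·_ : Op₂ (Fin n)) (S A : Subset n) where

  -- A copy of the decision procedure local to sumset, which is not exported;
  -- ∈-sumset⁻ typechecks because the two agree definitionally.
  sumset? : (x : Fin n) → Dec (∃ λ s → ∃ λ a → (s ∈ S × a ∈ A) × (s · a) ≡ x)
  sumset? x = any? λ s → any? λ a → ((s ∈? S) ×-dec (a ∈? A)) ×-dec ((s · a) ≟ x)

  ∈-sumset⁻ : ∀ {x} → x ∈ sumset _·_ S A → ∃ λ s → ∃ λ a → (s ∈ S × a ∈ A) × (s · a) ≡ x
  ∈-sumset⁻ = ∈-tabulate⁻ sumset?

module _ {n : ℕ} {_∙_ : Op₂ (Fin n)} {ε : Fin n} {_⁻¹ : Op₁ (Fin n)}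
         (isGroup : IsGroup _≡_ _∙_ ε _⁻¹) where

  open IsGroup isGroup using (_//_)
  private
    group : Group 0ℓ 0ℓ
    group = record { isGroup = isGroup }

  open GroupProperties group using (//-rightDividesˡ; //-rightDividesʳ)

  sum-translateʳ : (f : Fin n → ℕ) (a : Fin n) → sum (λ x → f (x // a)) ≡ sum f
  sum-translateʳ f a =
    sym (sum-permute f (permutation (_// a) (_∙ a) (//-rightDividesʳ a) (//-rightDividesˡ a)))

  representations : Subset n → Subset n → Fin n → ℕ
  representations S A x = sum λ a → 𝟙 A a * 𝟙 S (x // a)

  sum-representations : ∀ S A → sum (representations S A) ≡ ∣ A ∣ * ∣ S ∣
  sum-representations S A = begin
    sum (λ x → sum λ a → 𝟙 A a * 𝟙 S (x // a)) ≡⟨ ∑-comm (λ x a → 𝟙 A a * 𝟙 S (x // a)) ⟩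
    sum (λ a → sum λ x → 𝟙 A a * 𝟙 S (x // a)) ≡⟨ sum-cong-≗ (λ a → sym (*-distribˡ-sum (𝟙 A a) (λ x → 𝟙 S (x // a)))) ⟩
    sum (λ a → 𝟙 A a * sum λ x → 𝟙 S (x // a)) ≡⟨ sum-cong-≗ (λ a → cong (𝟙 A a *_) (sum-translateʳ (𝟙 S) a)) ⟩
    sum (λ a → 𝟙 A a * sum (𝟙 S))              ≡⟨ sym (*-distribʳ-sum (sum (𝟙 S)) (𝟙 A)) ⟩
    sum (𝟙 A) * sum (𝟙 S)                       ≡⟨ sym (cong₂ _*_ (∣p∣≡sum𝟙 A) (∣p∣≡sum𝟙 S)) ⟩
    ∣ A ∣ * ∣ S ∣                               ∎
    where open ≡-Reasoning

  𝟙-representation : ∀ {S A s a x} → s ∈ S → a ∈ A → s ∙ a ≡ x → 𝟙 A a * 𝟙 S (x // a) ≡ 1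
  𝟙-representation {s = s} {a} s∈S a∈A refl
    rewrite //-rightDividesʳ a s | x∈p⇒𝟙≡1 s∈S | x∈p⇒𝟙≡1 a∈A = refl

  2≤representations : ∀ {S A x} → (∀ a → a ∈ A → sumset _∙_ S A ≡ sumset _∙_ S (A - a))
                      → x ∈ sumset _∙_ S A → 2 ≤ representations S A x
  2≤representations {S} {A} {x} dropping x∈S∙A
    with s , a , (s∈S , a∈A) , s∙a≡x ← ∈-sumset⁻ _∙_ S A x∈S∙A
    with s′ , a′ , (s′∈S , a′∈A-a) , s′∙a′≡x ← ∈-sumset⁻ _∙_ S (A - a) (subst (x ∈_) (dropping a a∈A) x∈S∙A)
    = begin
      2                                 ≡⟨ sym (cong₂ _+_ (𝟙-representation s′∈S (p─q⊆p A ⁅ a ⁆ a′∈A-a) s′∙a′≡x)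
                                                         (𝟙-representation s∈S a∈A s∙a≡x)) ⟩
      f a′ + f a                        ≤⟨ f[i]+f[j]≤sum f (x∉⁅y⁆⇒x≢y (x∈p─q⇒x∉q a′∈A-a)) ⟩
      representations S A x             ∎
    where
    open ≤-Reasoning
    f : Fin n → ℕ
    f b = 𝟙 A b * 𝟙 S (x // b)

  2*∣S∙A∣≤∣A∣*∣S∣ : ∀ S A → (∀ a → a ∈ A → sumset _∙_ S A ≡ sumset _∙_ S (A - a))
                    → 2 * ∣ sumset _∙_ S A ∣ ≤ ∣ A ∣ * ∣ S ∣
  2*∣S∙A∣≤∣A∣*∣S∣ S A dropping = begin
    2 * ∣ sumset _∙_ S A ∣     ≤⟨ k*∣p∣≤sum 2 _ _ (λ _ → 2≤representations dropping) ⟩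
    sum (representations S A) ≡⟨ sum-representations S A ⟩
    ∣ A ∣ * ∣ S ∣              ∎
    where open ≤-Reasoning

lemma4p4 : {n : ℕ} (_+_ : Fin n → Fin n → Fin n) (0# : Fin n) (neg : Fin n → Fin n)
    → IsAbelianGroup _≡_ _+_ 0# neg
    → (A S : Subset n)
    → ∣ A ∣ ≡ 3
    → (∀ a → a ∈ A → sumset _+_ S A ≡ sumset _+_ S (A - a))
    → 2 * ∣ sumset _+_ S A ∣ ≤ 3 * ∣ S ∣
lemma4p4 _+_ 0# neg isAbelianGroup A S ∣A∣≡3 dropping =
  subst (λ k → 2 * ∣ sumset _+_ S A ∣ ≤ k * ∣ S ∣) ∣A∣≡3
    (2*∣S∙A∣≤∣A∣*∣S∣ (IsAbelianGroup.isGroup isAbelianGroup) S A dropping)
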